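{- Let $r\ge 2$ and let $\delta_1,\delta_2$ be non-negative integers satisfying $\delta_1+\delta_2=\lfloor 3r/2\rfloor$, $\delta_1\le r$, and $\delta_2\le r$. Then there exist two edge-subgraphs $X$ and $Y$ of $K_{r,r}$ such that $\delta(X)=\delta_1$, $\delta(Y)=\delta_2$, and the friends-and-strangers graph $\mathsf{FS}(X,Y)$ has more than two connected components.
   Context: $K_{r,r}$ is the complete bipartite graph with two parts of size $r$; an edge-subgraph of $K_{r,r}$ is a graph on the same $2r$ vertices whose edge set is a subset of that of $K_{r,r}$. For a simple graph $G$, $\delta(G)$ denotes its minimum degree. For two simple graphs $X$ and $Y$ with the same finite number of vertices, the friends-and-strangers graph $\mathsf{FS}(X,Y)$ has as vertex set all bijections $\sigma:V(X)\to V(Y)$; two bijections $\sigma,\tau$ are adjacent if and only if there are distinct vertices $a,b\in V(X)$ with $\{a,b\}\in E(X)$, $\{\sigma(a),\sigma(b)\}\in E(Y)$, $\tau(a)=\sigma(b)$, $\tau(b)=\sigma(a)$, and $\tau(w)=\sigma(w)$ for all $w\in V(X)\setminus\{a,b\}$. -}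

module Defs where

open import Data.Nat using (ℕ; zero; suc; _+_; _≤_)
open import Data.Fin using (Fin; zero; suc)
open import Data.Bool using (Bool; true; false; T)
open import Data.Sum using (_⊎_; inj₁; inj₂)
open import Data.Product using (Σ; ∃; _×_; _,_)
open import Data.Empty using (⊥)
open import Relation.Nullary using (¬_)
open import Relation.Binary.PropositionalEquality using (_≡_; _≢_)
open import Function.Bundles using (_↔_; Inverse)
open import Relation.Binary.Construct.Closure.ReflexiveTransitive using (Star)

V : ℕ → Set
V r = Fin r ⊎ Fin r

-- An edge-subgraph of K_{r,r} on the vertex set V r is determined by
-- which pairs (left vertex i, right vertex j) are edges.
BipSubgraph : ℕ → Set
BipSubgraph r = Fin r → Fin r → Bool

Adj : ∀ {r} → BipSubgraph r → V r → V r → Set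
Adj G (inj₁ i) (inj₂ j) = T (G i j)
Adj G (inj₂ j) (inj₁ i) = T (G i j)
Adj G (inj₁ _) (inj₁ _) = ⊥
Adj G (inj₂ _) (inj₂ _) = ⊥

count : ∀ {n} → (Fin n → Bool) → ℕ
count {zero} f = 0
count {suc n} f with f zero
... | true  = suc (count (λ k → f (suc k)))
... | false = count (λ k → f (suc k))

degree : ∀ {r} → BipSubgraph r → V r → ℕ
degree G (inj₁ i) = count (λ j → G i j)
degree G (inj₂ j) = count (λ i → G i j)

MinDegree : ∀ {r} → BipSubgraph r → ℕ → Set
MinDegree {r} G d = (∀ v → d ≤ degree G v) × (Σ (V r) λ v → degree G v ≡ d)

-- Vertices of FS(X,Y): bijections V(X) → V(Y) (here both are V r).
Bij : ℕ → Set
Bij r = V r ↔ V r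

FSAdj : ∀ {r} → BipSubgraph r → BipSubgraph r → Bij r → Bij r → Set
FSAdj {r} X Y σ τ =
  Σ (V r) λ a → Σ (V r) λ b →
    a ≢ b × Adj X a b × Adj Y (Inverse.to σ a) (Inverse.to σ b) ×
    Inverse.to τ a ≡ Inverse.to σ b × Inverse.to τ b ≡ Inverse.to σ a ×
    (∀ w → w ≢ a → w ≢ b → Inverse.to τ w ≡ Inverse.to σ w)

-- Two bijections are the same vertex of FS(X,Y) iff they agree pointwise.
SameBij : ∀ {r} → Bij r → Bij r → Set
SameBij {r} σ τ = ∀ (v : V r) → Inverse.to σ v ≡ Inverse.to τ v

-- Same connected component of FS(X,Y): joined by a finite walk
-- (steps are FS-edges, or identification of pointwise-equal bijections).
FSConnected : ∀ {r} → BipSubgraph r → BipSubgraph r → Bij r → Bij r → Set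
FSConnected X Y = Star (λ σ τ → FSAdj X Y σ τ ⊎ SameBij σ τ)

-- FS(X,Y) has more than two connected components: there are three
-- vertices lying in pairwise distinct components.
MoreThanTwoComponents : ∀ {r} → BipSubgraph r → BipSubgraph r → Set
MoreThanTwoComponents {r} X Y =
  Σ (Bij r) λ σ₁ → Σ (Bij r) λ σ₂ → Σ (Bij r) λ σ₃ →
    ¬ FSConnected X Y σ₁ σ₂ × ¬ FSConnected X Y σ₁ σ₃ × ¬ FSConnected X Y σ₂ σ₃

-- Split the indices of each side of K_{r,r} into a block A = [0, ⌊r/2⌋) and a block B of the
-- remaining ⌈r/2⌉ indices. Both X and Y contain every edge between A and B; inside A × A and
-- B × B, X is the circulant graph i ~ j ⟺ (i + j) mod n < s (n the block size) and Y is its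
-- complement. A circulant block is regular of degree min(s, n), which gives δ(X) = ⌊r/2⌋ + s and
-- δ(Y) = ⌊r/2⌋ + (⌈r/2⌉ - s). The bijection exchanging the two copies of A (likewise of B) maps
-- cross edges of X into one side of K_{r,r} and block edges of X onto non-edges of Y, so no swap
-- is possible from it: it is an isolated vertex of FS(X, Y). These two isolated vertices and the
-- identity lie in three different components.

module Submission where

open import Defs
open import Data.Nat using (ℕ; zero; suc; _+_; _*_; _∸_; _⊓_; _≤_; _<_; _<ᵇ_; _%_; NonZero; >-nonZero; >-nonZero⁻¹; z<s)
open import Data.Nat.DivMod using (_/_; [m+n]%n≡m%n; m<n⇒m%n≡m; m≥n⇒m/n>0; m/n≤m; m/n*n≤m; m*n/n≡m; +-distrib-/-∣ˡ; /-congˡ)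
open import Data.Nat.Divisibility using (n∣m*n)
open import Data.Nat.Properties
open import Data.Bool using (Bool; true; false; not; if_then_else_; T)
open import Data.Bool.Properties using (not-injective)
open import Data.Fin using (Fin; toℕ; fromℕ<)
import Data.Fin as Fin
open import Data.Fin.Properties using (toℕ<n; toℕ-fromℕ<)
open import Data.Sum using (inj₁; inj₂)
open import Data.Product using (Σ; _×_; _,_)
open import Data.Empty using (⊥; ⊥-elim)
open import Function using (_∘_; _∘′_; _∘₂_)
open import Function.Bundles using (Inverse; mk↔ₛ′)
open import Relation.Nullary using (¬_; yes; no)
open import Relation.Nullary.Decidable using (dec-true; dec-false)
open import Relation.Binary.PropositionalEquality
open import Relation.Binary.Construct.Closure.ReflexiveTransitive using (ε; _◅_)

indicator : Bool → ℕ
indicator true  = 1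
indicator false = 0

countFrom : ℕ → ℕ → (ℕ → Bool) → ℕ
countFrom k zero    P = 0
countFrom k (suc n) P = indicator (P k) + countFrom (suc k) n P

count-suc : ∀ {n} (f : Fin (suc n) → Bool) → count f ≡ indicator (f Fin.zero) + count (f ∘ Fin.suc)
count-suc f with f Fin.zero
... | true  = refl
... | false = refl

count≡countFrom : ∀ {n} k (f : Fin n → Bool) (P : ℕ → Bool) →
  (∀ j → f j ≡ P (k + toℕ j)) → count f ≡ countFrom k n P
count≡countFrom {zero}  k f P f≗P = refl
count≡countFrom {suc n} k f P f≗P = trans (count-suc f) (cong₂ _+_
  (cong indicator (trans (f≗P Fin.zero) (cong P (+-identityʳ k))))
  (count≡countFrom (suc k) (f ∘ Fin.suc) P λ j → trans (f≗P (Fin.suc j)) (cong P (+-suc k (toℕ j)))))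

countFrom-cong : ∀ k n {P Q : ℕ → Bool} → (∀ x → k ≤ x → x < k + n → P x ≡ Q x) →
  countFrom k n P ≡ countFrom k n Q
countFrom-cong k zero    P≗Q = refl
countFrom-cong k (suc n) P≗Q = cong₂ _+_
  (cong indicator (P≗Q k ≤-refl (m<m+n k z<s)))
  (countFrom-cong (suc k) n λ x k<x x<k+1+n → P≗Q x (<⇒≤ k<x) (subst (x <_) (sym (+-suc k n)) x<k+1+n))

countFrom-+ : ∀ k a b (P : ℕ → Bool) → countFrom k (a + b) P ≡ countFrom k a P + countFrom (k + a) b P
countFrom-+ k zero    b P = cong (λ i → countFrom i b P) (sym (+-identityʳ k))
countFrom-+ k (suc a) b P = begin
  indicator (P k) + countFrom (suc k) (a + b) P
    ≡⟨ cong (indicator (P k) +_) (countFrom-+ (suc k) a b P) ⟩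
  indicator (P k) + (countFrom (suc k) a P + countFrom (suc k + a) b P)
    ≡⟨ sym (+-assoc (indicator (P k)) _ _) ⟩
  indicator (P k) + countFrom (suc k) a P + countFrom (suc k + a) b P
    ≡⟨ cong (λ i → indicator (P k) + countFrom (suc k) a P + countFrom i b P) (sym (+-suc k a)) ⟩
  indicator (P k) + countFrom (suc k) a P + countFrom (k + suc a) b P ∎
  where open ≡-Reasoning

countFrom-snoc : ∀ k n (P : ℕ → Bool) → countFrom k (suc n) P ≡ countFrom k n P + indicator (P (k + n))
countFrom-snoc k n P = begin
  countFrom k (suc n) P           ≡⟨ cong (λ i → countFrom k i P) (+-comm 1 n) ⟩
  countFrom k (n + 1) P           ≡⟨ countFrom-+ k n 1 P ⟩
  countFrom k n P + (indicator (P (k + n)) + 0) ≡⟨ cong (countFrom k n P +_) (+-identityʳ _) ⟩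
  countFrom k n P + indicator (P (k + n)) ∎
  where open ≡-Reasoning

countFrom-shift : ∀ c k n (P : ℕ → Bool) → countFrom (c + k) n P ≡ countFrom k n (λ x → P (c + x))
countFrom-shift c k zero    P = refl
countFrom-shift c k (suc n) P = cong (indicator (P (c + k)) +_)
  (trans (cong (λ i → countFrom i n P) (sym (+-suc c k))) (countFrom-shift c (suc k) n P))

countFrom-rotate : ∀ k n (P : ℕ → Bool) → P (k + n) ≡ P k → countFrom (suc k) n P ≡ countFrom k n P
countFrom-rotate k zero    P _    = refl
countFrom-rotate k (suc n) P wrap = begin
  countFrom (suc k) (suc n) P
    ≡⟨ countFrom-snoc (suc k) n P ⟩
  countFrom (suc k) n P + indicator (P (suc k + n))
    ≡⟨ cong (λ x → countFrom (suc k) n P + indicator (P x)) (sym (+-suc k n)) ⟩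
  countFrom (suc k) n P + indicator (P (k + suc n))
    ≡⟨ cong (λ b → countFrom (suc k) n P + indicator b) wrap ⟩
  countFrom (suc k) n P + indicator (P k)
    ≡⟨ +-comm _ (indicator (P k)) ⟩
  countFrom k (suc n) P ∎
  where open ≡-Reasoning

countFrom-periodic : ∀ n (P : ℕ → Bool) → (∀ x → P (x + n) ≡ P x) →
  ∀ k → countFrom k n P ≡ countFrom 0 n P
countFrom-periodic n P periodic zero    = refl
countFrom-periodic n P periodic (suc k) =
  trans (countFrom-rotate k n P (periodic k)) (countFrom-periodic n P periodic k)

countFrom-true : ∀ k n (P : ℕ → Bool) → (∀ x → k ≤ x → x < k + n → P x ≡ true) → countFrom k n P ≡ n
countFrom-true k n P all = trans (countFrom-cong k n all) (const k n)
  where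
  const : ∀ k n → countFrom k n (λ _ → true) ≡ n
  const k zero    = refl
  const k (suc n) = cong suc (const (suc k) n)

countFrom-false : ∀ k n (P : ℕ → Bool) → (∀ x → k ≤ x → x < k + n → P x ≡ false) → countFrom k n P ≡ 0
countFrom-false k n P none = trans (countFrom-cong k n none) (const k n)
  where
  const : ∀ k n → countFrom k n (λ _ → false) ≡ 0
  const k zero    = refl
  const k (suc n) = const (suc k) n

countFrom-not+countFrom : ∀ k n (P : ℕ → Bool) → countFrom k n (not ∘ P) + countFrom k n P ≡ n
countFrom-not+countFrom k zero    P = refl
countFrom-not+countFrom k (suc n) P with P k
... | true  = trans (+-suc _ _) (cong suc (countFrom-not+countFrom (suc k) n P))
... | false = cong suc (countFrom-not+countFrom (suc k) n P)

countFrom-not : ∀ k n (P : ℕ → Bool) → countFrom k n (not ∘ P) ≡ n ∸ countFrom k n P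
countFrom-not k n P = begin
  countFrom k n (not ∘ P)                    ≡⟨ sym (m+n∸n≡m _ c) ⟩
  countFrom k n (not ∘ P) + c ∸ c            ≡⟨ cong (_∸ c) (countFrom-not+countFrom k n P) ⟩
  n ∸ c                                      ∎
  where
  open ≡-Reasoning
  c = countFrom k n P

countFrom-<ᵇ : ∀ n t → countFrom 0 n (_<ᵇ t) ≡ t ⊓ n
countFrom-<ᵇ n t with ≤-total t n
... | inj₁ t≤n = begin
  countFrom 0 n (_<ᵇ t)
    ≡⟨ cong (λ i → countFrom 0 i (_<ᵇ t)) (sym (m+[n∸m]≡n t≤n)) ⟩
  countFrom 0 (t + (n ∸ t)) (_<ᵇ t)
    ≡⟨ countFrom-+ 0 t (n ∸ t) (_<ᵇ t) ⟩
  countFrom 0 t (_<ᵇ t) + countFrom t (n ∸ t) (_<ᵇ t)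
    ≡⟨ cong₂ _+_ (countFrom-true 0 t _ λ x _ x<t → dec-true (x <? t) x<t)
                 (countFrom-false t (n ∸ t) _ λ x t≤x _ → dec-false (x <? t) (≤⇒≯ t≤x)) ⟩
  t + 0
    ≡⟨ trans (+-identityʳ t) (sym (m≤n⇒m⊓n≡m t≤n)) ⟩
  t ⊓ n ∎
  where open ≡-Reasoning
... | inj₂ n≤t = trans (countFrom-true 0 n _ λ x _ x<n → dec-true (x <? t) (<-≤-trans x<n n≤t))
                       (sym (m≥n⇒m⊓n≡n n≤t))

circulant : (n : ℕ) .{{_ : NonZero n}} → ℕ → ℕ → ℕ → Bool
circulant n t a b = (a + b) % n <ᵇ t

circulant-sym : ∀ n .{{_ : NonZero n}} t a b → circulant n t a b ≡ circulant n t b a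
circulant-sym n t a b = cong (λ x → x % n <ᵇ t) (+-comm a b)

circulant-count : ∀ n .{{_ : NonZero n}} t a k → countFrom k n (circulant n t a) ≡ t ⊓ n
circulant-count n t a k = begin
  countFrom k n (λ b → Q (a + b))  ≡⟨ countFrom-periodic n _ (λ b → trans (cong Q (sym (+-assoc a b n))) (Q-periodic _)) k ⟩
  countFrom 0 n (λ b → Q (a + b))  ≡⟨ sym (countFrom-shift a 0 n Q) ⟩
  countFrom (a + 0) n Q            ≡⟨ cong (λ i → countFrom i n Q) (+-identityʳ a) ⟩
  countFrom a n Q                  ≡⟨ countFrom-periodic n Q Q-periodic a ⟩
  countFrom 0 n Q                  ≡⟨ countFrom-cong 0 n (λ x _ x<n → cong (_<ᵇ t) (m<n⇒m%n≡m x<n)) ⟩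
  countFrom 0 n (_<ᵇ t)            ≡⟨ countFrom-<ᵇ n t ⟩
  t ⊓ n ∎
  where
  open ≡-Reasoning
  Q : ℕ → Bool
  Q x = x % n <ᵇ t
  Q-periodic : ∀ x → Q (x + n) ≡ Q x
  Q-periodic x = cong (_<ᵇ t) ([m+n]%n≡m%n x n)

graph : ∀ {r} → (ℕ → ℕ → Bool) → BipSubgraph r
graph F i j = F (toℕ i) (toℕ j)

Adj-sym : ∀ {r} (G : BipSubgraph r) u v → Adj G u v → Adj G v u
Adj-sym G (inj₁ i) (inj₂ j) e = e
Adj-sym G (inj₂ j) (inj₁ i) e = e

index : ∀ {r} → V r → ℕ
index (inj₁ i) = toℕ i
index (inj₂ j) = toℕ j

degree-graph : ∀ {r} (F : ℕ → ℕ → Bool) → (∀ a b → F a b ≡ F b a) →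
  ∀ (v : V r) → degree (graph F) v ≡ countFrom 0 r (F (index v))
degree-graph {r} F F-sym (inj₁ i) = count≡countFrom {r} 0 _ (F (toℕ i)) λ j → refl
degree-graph {r} F F-sym (inj₂ j) = count≡countFrom {r} 0 _ (F (toℕ j)) λ i → F-sym (toℕ i) (toℕ j)

MinDegree-graph : ∀ {r} (F : ℕ → ℕ → Bool) → (∀ a b → F a b ≡ F b a) → ∀ d →
  (∀ a → a < r → d ≤ countFrom 0 r (F a)) → ∀ {a₀} → a₀ < r → countFrom 0 r (F a₀) ≡ d →
  MinDegree (graph F) d
MinDegree-graph {r} F F-sym d lower {a₀} a₀<r attained =
  (λ v → subst (d ≤_) (sym (degree-graph F F-sym v)) (lower (index v) (index<r v))) ,
  (inj₁ (fromℕ< a₀<r) , trans (degree-graph F F-sym (inj₁ (fromℕ< a₀<r)))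
                              (trans (cong (countFrom 0 r ∘ F) (toℕ-fromℕ< a₀<r)) attained))
  where
  index<r : (v : V r) → index v < r
  index<r (inj₁ i) = toℕ<n i
  index<r (inj₂ j) = toℕ<n j

Isolated : ∀ {r} → BipSubgraph r → BipSubgraph r → Bij r → Set
Isolated X Y σ = ∀ u v → Adj X u v → ¬ Adj Y (Inverse.to σ u) (Inverse.to σ v)

module _ {r} {X Y : BipSubgraph r} {σ : Bij r} (isolated : Isolated X Y σ) where

  isolated-connected⇒same : ∀ {τ} → FSConnected X Y σ τ → SameBij σ τ
  isolated-connected⇒same = go (λ _ → refl)
    where
    go : ∀ {ρ τ} → SameBij σ ρ → FSConnected X Y ρ τ → SameBij σ τ
    go σ≗ρ ε = σ≗ρ
    go σ≗ρ (inj₂ ρ≗ρ′ ◅ rest) = go (λ v → trans (σ≗ρ v) (ρ≗ρ′ v)) rest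
    go σ≗ρ (inj₁ (a , b , _ , x-edge , y-edge , _) ◅ rest) =
      ⊥-elim (isolated a b x-edge (subst₂ (Adj Y) (sym (σ≗ρ a)) (sym (σ≗ρ b)) y-edge))

  isolated-¬connected : ∀ {τ} → ¬ SameBij σ τ → ¬ FSConnected X Y σ τ
  isolated-¬connected σ≉τ = σ≉τ ∘′ isolated-connected⇒same

two-isolated⇒MoreThanTwoComponents : ∀ {r} {X Y : BipSubgraph r} {σ₁ σ₂ τ : Bij r} →
  Isolated X Y σ₁ → Isolated X Y σ₂ → ¬ SameBij σ₁ σ₂ → ¬ SameBij σ₁ τ → ¬ SameBij σ₂ τ →
  MoreThanTwoComponents X Y
two-isolated⇒MoreThanTwoComponents {σ₁ = σ₁} {σ₂} {τ} iso₁ iso₂ σ₁≉σ₂ σ₁≉τ σ₂≉τ =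
  σ₁ , σ₂ , τ , isolated-¬connected iso₁ σ₁≉σ₂ , isolated-¬connected iso₁ σ₁≉τ , isolated-¬connected iso₂ σ₂≉τ

flip : ∀ {r} → (ℕ → Bool) → V r → V r
flip P (inj₁ i) = if P (toℕ i) then inj₂ i else inj₁ i
flip P (inj₂ j) = if P (toℕ j) then inj₁ j else inj₂ j

flip-involutive : ∀ {r} (P : ℕ → Bool) (v : V r) → flip P (flip P v) ≡ v
flip-involutive P (inj₁ i) with P (toℕ i) in eq
... | true  rewrite eq = refl
... | false rewrite eq = refl
flip-involutive P (inj₂ j) with P (toℕ j) in eq
... | true  rewrite eq = refl
... | false rewrite eq = refl

flipBij : ∀ {r} → (ℕ → Bool) → Bij r
flipBij P = mk↔ₛ′ (flip P) (flip P) (flip-involutive P) (flip-involutive P)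

flip-isolated : ∀ {r} (F G : ℕ → ℕ → Bool) (P : ℕ → Bool) → (∀ a b → G a b ≡ G b a) →
  (∀ a b → P a ≡ P b → T (F a b) → T (G a b) → ⊥) → Isolated {r} (graph F) (graph G) (flipBij P)
flip-isolated F G P G-sym disjoint (inj₂ j) (inj₁ i) x-edge y-edge =
  flip-isolated F G P G-sym disjoint (inj₁ i) (inj₂ j) x-edge
    (Adj-sym (graph G) (flip P (inj₂ j)) (flip P (inj₁ i)) y-edge)
flip-isolated F G P G-sym disjoint (inj₁ i) (inj₂ j) x-edge y-edge
  with P (toℕ i) in eqi | P (toℕ j) in eqj
... | true  | true  = disjoint _ _ (trans eqi (sym eqj)) x-edge (subst T (G-sym (toℕ j) (toℕ i)) y-edge)
... | true  | false = y-edge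
... | false | true  = y-edge
... | false | false = disjoint _ _ (trans eqi (sym eqj)) x-edge y-edge

flip-moves : ∀ {r} (P Q : ℕ → Bool) (k : Fin r) → P (toℕ k) ≡ true → Q (toℕ k) ≡ false →
  ¬ SameBij (flipBij P) (flipBij Q)
flip-moves {r} P Q k Pk Qk same with subst₂ _≡_ (cong image Pk) (cong image Qk) (same (inj₁ k))
  where
  image : Bool → V r
  image p = if p then inj₂ k else inj₁ k
... | ()

module Blocks (h : ℕ) where

  inA : ℕ → Bool
  inA a = a <ᵇ h

  inA-yes : ∀ {a} → a < h → inA a ≡ true
  inA-yes {a} = dec-true (a <? h)

  inA-no : ∀ {a} → h ≤ a → inA a ≡ false
  inA-no {a} h≤a = dec-false (a <? h) (≤⇒≯ h≤a)

  blockEntry : Bool → Bool → Bool → Bool → Bool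
  blockEntry true  true  x _ = x
  blockEntry true  false _ _ = true
  blockEntry false true  _ _ = true
  blockEntry false false _ y = y

  blocks : (EA EB : ℕ → ℕ → Bool) → ℕ → ℕ → Bool
  blocks EA EB a b = blockEntry (inA a) (inA b) (EA a b) (EB a b)

  blockEntry-comm : ∀ p q x y → blockEntry p q x y ≡ blockEntry q p x y
  blockEntry-comm true  true  x y = refl
  blockEntry-comm true  false x y = refl
  blockEntry-comm false true  x y = refl
  blockEntry-comm false false x y = refl

  blocks-sym : ∀ {EA EB} → (∀ a b → EA a b ≡ EA b a) → (∀ a b → EB a b ≡ EB b a) →
    ∀ a b → blocks EA EB a b ≡ blocks EA EB b a
  blocks-sym EA-sym EB-sym a b = trans (blockEntry-comm (inA a) (inA b) _ _)
    (cong₂ (blockEntry (inA b) (inA a)) (EA-sym a b) (EB-sym a b))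

  blockEntry-disjoint : ∀ p x y → T (blockEntry p p x y) → ¬ T (blockEntry p p (not x) (not y))
  blockEntry-disjoint true  true  _ _ ()
  blockEntry-disjoint false _ true  _ ()

  blocks-disjoint : ∀ {EA EB a b} → inA a ≡ inA b →
    T (blocks EA EB a b) → ¬ T (blocks (not ∘₂ EA) (not ∘₂ EB) a b)
  blocks-disjoint {EA} {EB} {a} {b} same = subst
    (λ q → T (blockEntry (inA a) q (EA a b) (EB a b)) → ¬ T (blockEntry (inA a) q (not (EA a b)) (not (EB a b))))
    same (blockEntry-disjoint (inA a) (EA a b) (EB a b))

  module _ (EA EB : ℕ → ℕ → Bool) where

    blocks-entry : ∀ {a b p q} → inA a ≡ p → inA b ≡ q →
      blocks EA EB a b ≡ blockEntry p q (EA a b) (EB a b)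
    blocks-entry refl refl = refl

    blocks-countA : ∀ m {a} → a < h → countFrom 0 (h + m) (blocks EA EB a) ≡ countFrom 0 h (EA a) + m
    blocks-countA m a<h = trans (countFrom-+ 0 h m _) (cong₂ _+_
      (countFrom-cong 0 h λ b _ b<h → blocks-entry (inA-yes a<h) (inA-yes b<h))
      (countFrom-true h m _ λ b h≤b _ → blocks-entry (inA-yes a<h) (inA-no h≤b)))

    blocks-countB : ∀ m {a} → h ≤ a → countFrom 0 (h + m) (blocks EA EB a) ≡ h + countFrom h m (EB a)
    blocks-countB m h≤a = trans (countFrom-+ 0 h m _) (cong₂ _+_
      (countFrom-true 0 h _ λ b _ b<h → blocks-entry (inA-no h≤a) (inA-yes b<h))
      (countFrom-cong h m λ b h≤b _ → blocks-entry (inA-no h≤a) (inA-no h≤b)))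

m+n≤n⊓m+o : ∀ {m n o} → m ≤ o → n ≤ o → m + n ≤ n ⊓ m + o
m+n≤n⊓m+o {m} {n} {o} m≤o n≤o with ≤-total n m
... | inj₁ n≤m rewrite m≤n⇒m⊓n≡m n≤m | +-comm m n = +-monoʳ-≤ n m≤o
... | inj₂ m≤n rewrite m≥n⇒m⊓n≡n m≤n = +-monoʳ-≤ m n≤o

m+[o∸n]≤[m∸n⊓m]+o : ∀ {m n o} → m ≤ o → n ≤ o → m + (o ∸ n) ≤ (m ∸ n ⊓ m) + o
m+[o∸n]≤[m∸n⊓m]+o {m} {n} {o} m≤o n≤o with ≤-total n m
... | inj₁ n≤m rewrite m≤n⇒m⊓n≡m n≤m = ≤-reflexive (trans (sym (+-∸-assoc m n≤o)) (+-∸-comm o n≤m))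
... | inj₂ m≤n rewrite m≥n⇒m⊓n≡n m≤n | n∸n≡0 m =
  ≤-trans (+-monoʳ-≤ m (∸-monoʳ-≤ o m≤n)) (≤-reflexive (m+[n∸m]≡n m≤o))

module Construction (h m s : ℕ) .{{_ : NonZero h}} (h≤m : h ≤ m) (s≤m : s ≤ m) where

  open Blocks h

  instance
    m-nonZero : NonZero m
    m-nonZero = >-nonZero (<-≤-trans (>-nonZero⁻¹ h) h≤m)

  Xedge Yedge : ℕ → ℕ → Bool
  Xedge = blocks (circulant h s) (circulant m s)
  Yedge = blocks (not ∘₂ circulant h s) (not ∘₂ circulant m s)

  Xedge-sym : ∀ a b → Xedge a b ≡ Xedge b a
  Xedge-sym = blocks-sym (circulant-sym h s) (circulant-sym m s)

  Yedge-sym : ∀ a b → Yedge a b ≡ Yedge b a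
  Yedge-sym = blocks-sym (λ a b → cong not (circulant-sym h s a b))
                         (λ a b → cong not (circulant-sym m s a b))

  X Y : BipSubgraph (h + m)
  X = graph Xedge
  Y = graph Yedge

  h<h+m : h < h + m
  h<h+m = m<m+n h (>-nonZero⁻¹ m)

  X-minDegree : MinDegree X (h + s)
  X-minDegree = MinDegree-graph Xedge Xedge-sym (h + s) lower h<h+m (countB ≤-refl)
    where
    countA : ∀ {a} → a < h → countFrom 0 (h + m) (Xedge a) ≡ s ⊓ h + m
    countA {a} a<h = trans (blocks-countA (circulant h s) (circulant m s) m a<h)
      (cong (_+ m) (circulant-count h s a 0))
    countB : ∀ {a} → h ≤ a → countFrom 0 (h + m) (Xedge a) ≡ h + s
    countB {a} h≤a = trans (blocks-countB (circulant h s) (circulant m s) m h≤a)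
      (cong (h +_) (trans (circulant-count m s a h) (m≤n⇒m⊓n≡m s≤m)))
    lower : ∀ a → a < h + m → h + s ≤ countFrom 0 (h + m) (Xedge a)
    lower a _ with a <? h
    ... | yes a<h = subst (h + s ≤_) (sym (countA a<h)) (m+n≤n⊓m+o h≤m s≤m)
    ... | no  a≮h = ≤-reflexive (sym (countB (≮⇒≥ a≮h)))

  Y-minDegree : MinDegree Y (h + (m ∸ s))
  Y-minDegree = MinDegree-graph Yedge Yedge-sym (h + (m ∸ s)) lower h<h+m (countB ≤-refl)
    where
    countA : ∀ {a} → a < h → countFrom 0 (h + m) (Yedge a) ≡ (h ∸ s ⊓ h) + m
    countA {a} a<h = trans (blocks-countA (not ∘₂ circulant h s) (not ∘₂ circulant m s) m a<h)
      (cong (_+ m) (trans (countFrom-not 0 h (circulant h s a)) (cong (h ∸_) (circulant-count h s a 0))))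
    countB : ∀ {a} → h ≤ a → countFrom 0 (h + m) (Yedge a) ≡ h + (m ∸ s)
    countB {a} h≤a = trans (blocks-countB (not ∘₂ circulant h s) (not ∘₂ circulant m s) m h≤a)
      (cong (h +_) (trans (countFrom-not h m (circulant m s a))
                          (cong (m ∸_) (trans (circulant-count m s a h) (m≤n⇒m⊓n≡m s≤m)))))
    lower : ∀ a → a < h + m → h + (m ∸ s) ≤ countFrom 0 (h + m) (Yedge a)
    lower a _ with a <? h
    ... | yes a<h = subst (h + (m ∸ s) ≤_) (sym (countA a<h)) (m+[o∸n]≤[m∸n⊓m]+o h≤m s≤m)
    ... | no  a≮h = ≤-reflexive (sym (countB (≮⇒≥ a≮h)))

  inB : ℕ → Bool
  inB = not ∘ inA

  components : MoreThanTwoComponents X Y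
  components =
    two-isolated⇒MoreThanTwoComponents {σ₁ = flipBij inA} {flipBij inB} {flipBij (λ _ → false)}
    (flip-isolated Xedge Yedge inA Yedge-sym λ a b →
      blocks-disjoint {circulant h s} {circulant m s})
    (flip-isolated Xedge Yedge inB Yedge-sym λ a b inB-same →
      blocks-disjoint {circulant h s} {circulant m s} (not-injective inB-same))
    (flip-moves inA inB vertexA inA-vertexA (cong not inA-vertexA))
    (flip-moves inA (λ _ → false) vertexA inA-vertexA refl)
    (flip-moves inB (λ _ → false) vertexB (cong not inA-vertexB) refl)
    where
    vertexA vertexB : Fin (h + m)
    vertexA = fromℕ< (<-≤-trans (>-nonZero⁻¹ h) (m≤m+n h m))
    vertexB = fromℕ< h<h+m
    inA-vertexA : inA (toℕ vertexA) ≡ true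
    inA-vertexA = trans (cong inA (toℕ-fromℕ< _)) (inA-yes (>-nonZero⁻¹ h))
    inA-vertexB : inA (toℕ vertexB) ≡ false
    inA-vertexB = trans (cong inA (toℕ-fromℕ< h<h+m)) (inA-no ≤-refl)

block-construction : ∀ {r δ₁ δ₂} h m s .{{_ : NonZero h}} → h ≤ m → s ≤ m →
  r ≡ h + m → δ₁ ≡ h + s → δ₂ ≡ h + (m ∸ s) →
  Σ (BipSubgraph r) λ X → Σ (BipSubgraph r) λ Y →
    MinDegree X δ₁ × MinDegree Y δ₂ × MoreThanTwoComponents X Y
block-construction h m s h≤m s≤m refl refl refl = X , Y , X-minDegree , Y-minDegree , components
  where open Construction h m s h≤m s≤m

degree-split : ∀ h m δ₁ δ₂ → δ₁ + δ₂ ≡ (h + m) + h → δ₁ ≤ h + m → δ₂ ≤ h + m →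
  Σ ℕ λ s → s ≤ m × δ₁ ≡ h + s × δ₂ ≡ h + (m ∸ s)
degree-split h m δ₁ δ₂ δ₁+δ₂≡ δ₁≤ δ₂≤ = s , s≤m , δ₁≡h+s , δ₂≡
  where
  open ≡-Reasoning
  h≤δ₁ : h ≤ δ₁
  h≤δ₁ = +-cancelʳ-≤ (h + m) h δ₁
    (subst (_≤ δ₁ + (h + m)) (trans δ₁+δ₂≡ (+-comm (h + m) h)) (+-monoʳ-≤ δ₁ δ₂≤))
  s : ℕ
  s = δ₁ ∸ h
  δ₁≡h+s : δ₁ ≡ h + s
  δ₁≡h+s = sym (m+[n∸m]≡n h≤δ₁)
  s≤m : s ≤ m
  s≤m = +-cancelˡ-≤ h s m (subst (_≤ h + m) δ₁≡h+s δ₁≤)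
  s+δ₂≡m+h : s + δ₂ ≡ m + h
  s+δ₂≡m+h = +-cancelˡ-≡ h (s + δ₂) (m + h) (begin
    h + (s + δ₂)   ≡⟨ sym (+-assoc h s δ₂) ⟩
    h + s + δ₂     ≡⟨ cong (_+ δ₂) (sym δ₁≡h+s) ⟩
    δ₁ + δ₂        ≡⟨ δ₁+δ₂≡ ⟩
    h + m + h      ≡⟨ +-assoc h m h ⟩
    h + (m + h)    ∎)
  δ₂≡ : δ₂ ≡ h + (m ∸ s)
  δ₂≡ = begin
    δ₂             ≡⟨ sym (m+n∸m≡n s δ₂) ⟩
    s + δ₂ ∸ s     ≡⟨ cong (_∸ s) s+δ₂≡m+h ⟩
    m + h ∸ s      ≡⟨ +-∸-comm h s≤m ⟩
    m ∸ s + h      ≡⟨ +-comm (m ∸ s) h ⟩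
    h + (m ∸ s)    ∎

[3*n]/2≡n+n/2 : ∀ n → 3 * n / 2 ≡ n + n / 2
[3*n]/2≡n+n/2 n = begin
  3 * n / 2          ≡⟨ /-congˡ (trans (+-comm n (n + (n + 0))) (cong (_+ n) (*-comm 2 n))) ⟩
  (n * 2 + n) / 2    ≡⟨ +-distrib-/-∣ˡ n (n∣m*n n) ⟩
  n * 2 / 2 + n / 2  ≡⟨ cong (_+ n / 2) (m*n/n≡m n 2) ⟩
  n + n / 2          ∎
  where open ≡-Reasoning

n/2≤n∸n/2 : ∀ n → n / 2 ≤ n ∸ n / 2
n/2≤n∸n/2 n = m+n≤o⇒m≤o∸n (n / 2) (subst (_≤ n) [n/2]*2≡n/2+n/2 (m/n*n≤m n 2))
  where
  [n/2]*2≡n/2+n/2 : n / 2 * 2 ≡ n / 2 + n / 2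
  [n/2]*2≡n/2+n/2 = trans (*-comm (n / 2) 2) (cong (n / 2 +_) (+-identityʳ (n / 2)))

theorem1p11 : (r : ℕ) → 2 ≤ r → (δ₁ δ₂ : ℕ) →
    δ₁ + δ₂ ≡ (3 * r) / 2 → δ₁ ≤ r → δ₂ ≤ r →
    Σ (BipSubgraph r) λ X → Σ (BipSubgraph r) λ Y →
      MinDegree X δ₁ × MinDegree Y δ₂ × MoreThanTwoComponents X Y
theorem1p11 r 2≤r δ₁ δ₂ δ₁+δ₂≡ δ₁≤r δ₂≤r =
  let s , s≤m , δ₁≡ , δ₂≡ = degree-split h m δ₁ δ₂ δ₁+δ₂≡h+m+h
                              (subst (δ₁ ≤_) r≡h+m δ₁≤r) (subst (δ₂ ≤_) r≡h+m δ₂≤r)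
  in block-construction h m s {{>-nonZero (m≥n⇒m/n>0 2≤r)}} (n/2≤n∸n/2 r) s≤m r≡h+m δ₁≡ δ₂≡
  where
  h m : ℕ
  h = r / 2
  m = r ∸ h
  r≡h+m : r ≡ h + m
  r≡h+m = sym (m+[n∸m]≡n (m/n≤m r 2))
  δ₁+δ₂≡h+m+h : δ₁ + δ₂ ≡ (h + m) + h
  δ₁+δ₂≡h+m+h = trans δ₁+δ₂≡ (trans ([3*n]/2≡n+n/2 r) (cong (_+ h) r≡h+m))
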